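{- The bond lattice $L(C_4)$ of the cycle graph $C_4$ on four vertices is not isomorphic to the core of any upho lattice.
   Context: For a connected simple graph $G$ on vertex set $[n]$, a set partition $\pi$ of $[n]$ is $G$-connected if the induced subgraph of $G$ on each block of $\pi$ is connected; the bond lattice $L(G)$ is the set of $G$-connected partitions ordered by refinement ($\pi\le\pi'$ iff every block of $\pi$ is contained in a block of $\pi'$). $C_4$ is the graph on $\{1,2,3,4\}$ with edges $\{1,2\},\{2,3\},\{3,4\},\{4,1\}$. A poset $\mathcal{P}$ is finite type $\mathbb{N}$-graded if it has a minimum $\hat0$, a rank function $\rho$ with $\rho(\hat0)=0$ such that every maximal chain has the form $\hat0=x_0\lessdot x_1\lessdot\cdots$ with $\rho(x_i)=i$, and finitely many elements of each rank. An upho lattice is a finite type $\mathbb{N}$-graded lattice $\mathcal{L}$ with at least two elements such that for every $p\in\mathcal{L}$ the principal filter $\{q\ge p\}$ is isomorphic to $\mathcal{L}$. Its core is the interval $[\hat0,s_1\vee\cdots\vee s_r]$ with $s_1,\ldots,s_r$ the atoms of $\mathcal{L}$. -}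

module Defs where

open import Data.Nat using (ℕ; zero; suc) renaming (_<_ to _<ℕ_)
open import Data.Bool using (Bool; true; false; T)
open import Data.Fin using (Fin; zero; suc)
open import Data.List using (List)
open import Data.List.Membership.Propositional using (_∈_)
open import Data.Product using (Σ; ∃; ∃₂; _×_; _,_; proj₁)
open import Relation.Nullary using (¬_)
open import Relation.Binary.PropositionalEquality using (_≡_; _≢_)
open import Relation.Binary.Structures using (IsPartialOrder)

-- Order isomorphism between two (pre)ordered types.
-- Monotone maps both ways that are mutually inverse up to the order
-- (i.e. up to x ≤ y × y ≤ x, which is equality in a poset).

record OrdIso {A B : Set} (_≤A_ : A → A → Set) (_≤B_ : B → B → Set) : Set where
  field
    to        : A → B
    from      : B → A
    to-mono   : ∀ {x y} → x ≤A y → to x ≤B to y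
    from-mono : ∀ {x y} → x ≤B y → from x ≤A from y
    from-to-≤ : ∀ x → from (to x) ≤A x
    from-to-≥ : ∀ x → x ≤A from (to x)
    to-from-≤ : ∀ y → to (from y) ≤B y
    to-from-≥ : ∀ y → y ≤B to (from y)

record UphoLattice : Set₁ where
  infix 4 _≤_ _<_ _⋖_
  field
    Carrier        : Set
    _≤_            : Carrier → Carrier → Set
    isPartialOrder : IsPartialOrder _≡_ _≤_

  _<_ : Carrier → Carrier → Set
  x < y = x ≤ y × x ≢ y

  _⋖_ : Carrier → Carrier → Set
  x ⋖ y = x < y × (∀ z → ¬ (x < z × z < y))

  field
    _∨_      : Carrier → Carrier → Carrier
    ∨-ubˡ    : ∀ x y → x ≤ x ∨ y
    ∨-ubʳ    : ∀ x y → y ≤ x ∨ y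
    ∨-least  : ∀ {x y z} → x ≤ z → y ≤ z → x ∨ y ≤ z
    _∧_      : Carrier → Carrier → Carrier
    ∧-lbˡ    : ∀ x y → x ∧ y ≤ x
    ∧-lbʳ    : ∀ x y → x ∧ y ≤ y
    ∧-greatest : ∀ {x y z} → z ≤ x → z ≤ y → z ≤ x ∧ y
    bot      : Carrier
    bot-min  : ∀ x → bot ≤ x
    ρ        : Carrier → ℕ
    ρ-bot    : ρ bot ≡ 0
    ρ-strict : ∀ {x y} → x < y → ρ x <ℕ ρ y
    ρ-cover  : ∀ {x y} → x ⋖ y → ρ y ≡ suc (ρ x)
    rank-finite : ∀ n → Σ (List Carrier) (λ xs → ∀ x → ρ x ≡ n → x ∈ xs)
    nontrivial : ∃₂ λ (x y : Carrier) → x ≢ y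
    upho : ∀ p → OrdIso {Σ Carrier (λ q → p ≤ q)} {Carrier}
                        (λ a b → proj₁ a ≤ proj₁ b) _≤_

  Atom : Carrier → Set
  Atom s = bot ⋖ s

  IsJoinOfAtoms : Carrier → Set
  IsJoinOfAtoms j = (∀ s → Atom s → s ≤ j)
                  × (∀ u → (∀ s → Atom s → s ≤ u) → j ≤ u)

  CoreElem : Carrier → Set
  CoreElem j = Σ Carrier (λ x → x ≤ j)

  _≤core_ : ∀ {j} → CoreElem j → CoreElem j → Set
  a ≤core b = proj₁ a ≤ proj₁ b

Graph : ℕ → Set
Graph n = Fin n → Fin n → Bool

-- a set partition of Fin n, given as its (Bool-valued) equivalence relation
-- "i and j lie in the same block"
Rel : ℕ → Set
Rel n = Fin n → Fin n → Bool

IsEquivB : ∀ {n} → Rel n → Set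
IsEquivB R = (∀ i → T (R i i))
           × (∀ i j → T (R i j) → T (R j i))
           × (∀ i j k → T (R i j) → T (R j k) → T (R i k))

data Path {n} (G : Graph n) (S : Fin n → Bool) : Fin n → Fin n → Set where
  here : ∀ {i} → Path G S i i
  step : ∀ {i j k} → T (G i j) → T (S j) → Path G S j k → Path G S i k

-- each block (the block of i is {k | R i k}) induces a connected subgraph
GConnected : ∀ {n} → Graph n → Rel n → Set
GConnected G R = ∀ i j → T (R i j) → Path G (R i) i j

BondElem : ∀ {n} → Graph n → Set
BondElem {n} G = Σ (Rel n) (λ R → IsEquivB R × GConnected G R)

_≤bond_ : ∀ {n} {G : Graph n} → BondElem G → BondElem G → Set
_≤bond_ {n} (R , _) (R' , _) = ∀ (i j : Fin n) → T (R i j) → T (R' i j)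

-- the 4-cycle with edges {1,2},{2,3},{3,4},{4,1}; vertex k is Fin index k-1
C4 : Graph 4
C4 zero (suc zero) = true
C4 (suc zero) zero = true
C4 (suc zero) (suc (suc zero)) = true
C4 (suc (suc zero)) (suc zero) = true
C4 (suc (suc zero)) (suc (suc (suc zero))) = true
C4 (suc (suc (suc zero))) (suc (suc zero)) = true
C4 (suc (suc (suc zero))) zero = true
C4 zero (suc (suc (suc zero))) = true
C4 _ _ = false

module Submission where

-- Suppose ψ identifies the core [bot, j] of an upho lattice L with L(C₄), and let s ≠ bot
-- correspond to an edge of C₄. The filter above s is isomorphic to L via some φ, which sends the
-- three covers of s in the core (the partitions 012|3, 013|2 and 01|23) to three distinct atoms
-- of L. Atoms lie in the core, where they are edges of C₄, and any three distinct edges connect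
-- the whole cycle; hence j ≤ φ(j), that is φ⁻¹(j) ≤ j. But φ⁻¹ is an order embedding with
-- bot < s ≤ φ⁻¹(bot), so the iterates φ⁻ⁿ(bot) form strictly increasing chains below j of every
-- length, which the rank function forbids.

open import Defs
open import Data.Empty using (⊥)
open import Data.Nat using (ℕ; zero; suc; z≤n) renaming (_≤_ to _≤ℕ_)
open import Data.Nat.Properties using (<-irrefl; ≤-<-trans)
open import Data.Bool using (Bool; T; _∧_; _∨_)
open import Data.Bool.Properties using (T-∧; T-∨)
open import Data.Fin using (Fin; _≟_; #_)
open import Data.Fin.Properties using (all?; any?)
open import Data.List using (foldr; map; allFin)
open import Data.Maybe using (Maybe; just; nothing; _<∣>_; is-just; to-witness-T)
open import Data.Product using (Σ; ∃; ∃₂; _×_; _,_; proj₁; proj₂)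
open import Data.Sum using (_⊎_; inj₁; inj₂; [_,_]; map₁; map₂) renaming (map to ⊎-map)
open import Data.Vec using ([]; _∷_; lookup)
open import Function.Base using (_on_; _∘′_)
open import Function.Bundles using (Equivalence)
open import Relation.Nullary using (¬_; Dec; yes; no; contradiction)
open import Relation.Nullary.Decidable
  using (True; ⌊_⌋; T?; ¬?; toWitness; fromWitness; from-yes; _×-dec_; _→-dec_)
open import Relation.Binary.Definitions using (Transitive)
open import Relation.Binary.PropositionalEquality using (_≡_; _≢_; refl; sym; trans; subst)
open import Relation.Binary.Structures using (IsPartialOrder)

-- Covers in preorders

record Cover {A : Set} (_≤_ : A → A → Set) (x y : A) : Set where
  field
    below      : x ≤ y
    ¬above     : ¬ (y ≤ x)
    no-between : ∀ {z} → x ≤ z → z ≤ y → z ≤ x ⊎ y ≤ z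

Cover-respˡ : {A : Set} {_≤_ : A → A → Set} → Transitive _≤_
            → ∀ {x x′ y} → x ≤ x′ → x′ ≤ x → Cover _≤_ x y → Cover _≤_ x′ y
Cover-respˡ ≤-trans x≤x′ x′≤x x⋖y = record
  { below      = ≤-trans x′≤x below
  ; ¬above     = λ y≤x′ → ¬above (≤-trans y≤x′ x′≤x)
  ; no-between = λ x′≤z z≤y →
      map₁ (λ z≤x → ≤-trans z≤x x≤x′) (no-between (≤-trans x≤x′ x′≤z) z≤y)
  }
  where open Cover x⋖y

module _ {A : Set} {_≤_ : A → A → Set} {P : A → Set} where

  Cover-restrict : ∀ {a b : Σ A P} → Cover _≤_ (proj₁ a) (proj₁ b) → Cover (_≤_ on proj₁) a b
  Cover-restrict a⋖b = record { below = below ; ¬above = ¬above ; no-between = no-between }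
    where open Cover a⋖b

  Cover-extend : ∀ {a b : Σ A P} → (∀ {z} → proj₁ a ≤ z → z ≤ proj₁ b → P z)
               → Cover (_≤_ on proj₁) a b → Cover _≤_ (proj₁ a) (proj₁ b)
  Cover-extend convex a⋖b = record
    { below      = below
    ; ¬above     = ¬above
    ; no-between = λ a≤z z≤b → no-between {_ , convex a≤z z≤b} a≤z z≤b
    }
    where open Cover a⋖b

OrdIso-sym : {A B : Set} {_≤A_ : A → A → Set} {_≤B_ : B → B → Set}
           → OrdIso _≤A_ _≤B_ → OrdIso _≤B_ _≤A_
OrdIso-sym ψ = record
  { to        = from      ; from      = to
  ; to-mono   = from-mono ; from-mono = to-mono
  ; from-to-≤ = to-from-≤ ; from-to-≥ = to-from-≥
  ; to-from-≤ = from-to-≤ ; to-from-≥ = from-to-≥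
  }
  where open OrdIso ψ

module OrdIsoProperties {A B : Set} {_≤A_ : A → A → Set} {_≤B_ : B → B → Set}
         (≤A-trans : Transitive _≤A_) (≤B-trans : Transitive _≤B_)
         (ψ : OrdIso _≤A_ _≤B_) where
  open OrdIso ψ

  from-reflects : ∀ {x y} → from x ≤A from y → x ≤B y
  from-reflects h = ≤B-trans (to-from-≥ _) (≤B-trans (to-mono h) (to-from-≤ _))

  Cover-from : ∀ {x y} → Cover _≤B_ x y → Cover _≤A_ (from x) (from y)
  Cover-from {x} {y} x⋖y = record
    { below      = from-mono below
    ; ¬above     = λ y≤x → ¬above (from-reflects y≤x)
    ; no-between = λ x≤z z≤y →
        ⊎-map (λ z≤x → ≤A-trans (from-to-≥ _) (from-mono z≤x))
              (λ y≤z → ≤A-trans (from-mono y≤z) (from-to-≤ _))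
              (no-between (≤B-trans (to-from-≥ x) (to-mono x≤z))
                          (≤B-trans (to-mono z≤y) (to-from-≤ y)))
    }
    where open Cover x⋖y

-- Upho lattices

module UphoProperties (L : UphoLattice) where
  open UphoLattice L
  open IsPartialOrder isPartialOrder using (antisym; reflexive; ≲-respʳ-≈)
    renaming (trans to ≤-trans; refl to ≤-refl)
  open import Relation.Binary.Construct.NonStrictToStrict _≡_ _≤_ using (<-≤-trans)
  open import Function.Endo.Propositional Carrier using (_^_)

  Cover⇒⋖ : ∀ {x y} → Cover _≤_ x y → x ⋖ y
  Cover⇒⋖ x⋖y = (below , λ x≡y → ¬above (reflexive (sym x≡y))) , nothing-between
    where
      open Cover x⋖y
      nothing-between : ∀ z → ¬ (_ < z × z < _)
      nothing-between z ((x≤z , x≢z) , (z≤y , z≢y)) =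
        [ (λ z≤x → x≢z (antisym x≤z z≤x)) , (λ y≤z → z≢y (antisym z≤y y≤z)) ] (no-between x≤z z≤y)

  atom-≤-nonzero-below : ∀ {a z} → Cover _≤_ bot a → ¬ (z ≤ bot) → z ≤ a → a ≤ z
  atom-≤-nonzero-below bot⋖a z≰bot z≤a =
    [ (λ z≤bot → contradiction z≤bot z≰bot) , (λ a≤z → a≤z) ] (Cover.no-between bot⋖a (bot-min _) z≤a)

  module _ (f : Carrier → Carrier) (f-mono : ∀ {x y} → x ≤ y → f x ≤ f y)
           (f-reflects : ∀ {x y} → f x ≤ f y → x ≤ y) (bot<f[bot] : bot < f bot) where

    private
      f-strict : ∀ {x y} → x < y → f x < f y
      f-strict (x≤y , x≢y) =
        f-mono x≤y , λ fx≡fy → x≢y (antisym x≤y (f-reflects (reflexive (sym fx≡fy))))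

      iterate-increasing : ∀ n → (f ^ n) bot < (f ^ suc n) bot
      iterate-increasing zero    = bot<f[bot]
      iterate-increasing (suc n) = f-strict (iterate-increasing n)

      rank-of-iterate : ∀ n → n ≤ℕ ρ ((f ^ n) bot)
      rank-of-iterate zero    = z≤n
      rank-of-iterate (suc n) = ≤-<-trans (rank-of-iterate n) (ρ-strict (iterate-increasing n))

    f[x]≰x : ∀ x → ¬ (f x ≤ x)
    f[x]≰x x fx≤x = <-irrefl refl (≤-<-trans (rank-of-iterate (ρ x)) (ρ-strict (iterate<x (ρ x))))
      where
        iterate≤x : ∀ n → (f ^ n) bot ≤ x
        iterate≤x zero    = bot-min x
        iterate≤x (suc n) = ≤-trans (f-mono (iterate≤x n)) fx≤x

        iterate<x : ∀ n → (f ^ n) bot < x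
        iterate<x n = <-≤-trans sym ≤-trans antisym ≲-respʳ-≈ (iterate-increasing n) (iterate≤x (suc n))

  module Filter (p : Carrier) where
    open OrdIso (upho p)

    φ : ∀ {q} → p ≤ q → Carrier
    φ p≤q = to (_ , p≤q)

    φ⁻¹ : Carrier → Carrier
    φ⁻¹ x = proj₁ (from x)

    φ-mono : ∀ {q r} (p≤q : p ≤ q) (p≤r : p ≤ r) → q ≤ r → φ p≤q ≤ φ p≤r
    φ-mono _ _ = to-mono

    φ-reflects : ∀ {q r} (p≤q : p ≤ q) (p≤r : p ≤ r) → φ p≤q ≤ φ p≤r → q ≤ r
    φ-reflects _ _ = OrdIsoProperties.from-reflects ≤-trans ≤-trans (OrdIso-sym (upho p))

    φ⁻¹-mono : ∀ {x y} → x ≤ y → φ⁻¹ x ≤ φ⁻¹ y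
    φ⁻¹-mono = from-mono

    φ⁻¹-reflects : ∀ {x y} → φ⁻¹ x ≤ φ⁻¹ y → x ≤ y
    φ⁻¹-reflects = OrdIsoProperties.from-reflects ≤-trans ≤-trans (upho p)

    φ⁻¹∘φ≤ : ∀ {q} (p≤q : p ≤ q) → φ⁻¹ (φ p≤q) ≤ q
    φ⁻¹∘φ≤ p≤q = from-to-≤ (_ , p≤q)

    bot<φ⁻¹[bot] : ¬ (p ≤ bot) → bot < φ⁻¹ bot
    bot<φ⁻¹[bot] p≰bot =
      bot-min _ , λ bot≡φ⁻¹[bot] → p≰bot (≤-trans (proj₂ (from bot)) (reflexive (sym bot≡φ⁻¹[bot])))

    upho-cover⇒atom : ∀ {q} (p≤q : p ≤ q) → Cover _≤_ p q → Cover _≤_ bot (φ p≤q)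
    upho-cover⇒atom p≤q p⋖q =
      Cover-respˡ ≤-trans φ[p]≤bot (bot-min _)
        (OrdIsoProperties.Cover-from ≤-trans ≤-trans (OrdIso-sym (upho p))
           (Cover-restrict {a = p , ≤-refl} {b = _ , p≤q} p⋖q))
      where
        φ[p]≤bot : φ ≤-refl ≤ bot
        φ[p]≤bot = ≤-trans (to-mono {p , ≤-refl} {from bot} (proj₂ (from bot))) (to-from-≤ bot)

-- Bond lattices

private variable n : ℕ

infix 4 _⊆_
_⊆_ : Rel n → Rel n → Set
P ⊆ Q = ∀ i j → T (P i j) → T (Q i j)

_⊆?_ : (P Q : Rel n) → Dec (P ⊆ Q)
P ⊆? Q = all? λ i → all? λ j → T? (P i j) →-dec T? (Q i j)

discreteRel : Rel n
discreteRel i j = ⌊ i ≟ j ⌋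

-- For an equivalence relation P this is the join of P with the partition whose only
-- non-singleton block is {u, v}.
infixl 5 _+[_,_]
_+[_,_] : Rel n → Fin n → Fin n → Rel n
(P +[ u , v ]) i j = P i j ∨ (P i u ∧ P v j) ∨ (P i v ∧ P u j)

+[,]-cases : ∀ (P : Rel n) {u v i j} → T ((P +[ u , v ]) i j)
           → T (P i j) ⊎ (T (P i u) × T (P v j)) ⊎ (T (P i v) × T (P u j))
+[,]-cases P {u} {v} {i} {j} p =
  map₂ (⊎-map (Equivalence.to T-∧) (Equivalence.to T-∧))
       (map₂ (Equivalence.to (T-∨ {P i u ∧ P v j})) (Equivalence.to (T-∨ {P i j}) p))

+[,]-relates : ∀ (P : Rel n) u v → (∀ i → T (P i i)) → T ((P +[ u , v ]) u v)
+[,]-relates P u v P-refl =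
  Equivalence.from (T-∨ {P u v}) (inj₂ (Equivalence.from (T-∨ {P u u ∧ P v v})
    (inj₁ (Equivalence.from T-∧ (P-refl u , P-refl v)))))

module _ {G : Graph n} where

  rel : BondElem G → Rel n
  rel = proj₁

  module _ (R : BondElem G) where
    rel-refl : ∀ i → T (rel R i i)
    rel-refl = proj₁ (proj₁ (proj₂ R))

    rel-sym : ∀ {i j} → T (rel R i j) → T (rel R j i)
    rel-sym = proj₁ (proj₂ (proj₁ (proj₂ R))) _ _

    rel-trans : ∀ {i j k} → T (rel R i j) → T (rel R j k) → T (rel R i k)
    rel-trans = proj₂ (proj₂ (proj₁ (proj₂ R))) _ _ _

  ≤bond-trans : Transitive (_≤bond_ {G = G})
  ≤bond-trans P≤Q Q≤R i j = Q≤R i j ∘′ P≤Q i j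

  discrete : BondElem G
  discrete = discreteRel , equivalence , connected
    where
      equivalence : IsEquivB discreteRel
      equivalence = (λ i → fromWitness refl)
                  , (λ i j i≡j → fromWitness (sym (toWitness i≡j)))
                  , (λ i j k i≡j j≡k → fromWitness (trans (toWitness i≡j) (toWitness j≡k)))

      connected : GConnected G discreteRel
      connected i j i≡j = subst (Path G (discreteRel i) i) (toWitness i≡j) here

  discrete-least : ∀ R → discrete ≤bond R
  discrete-least R i j i≡j = subst (λ k → T (rel R i k)) (toWitness i≡j) (rel-refl R i)

  edge-or-discrete : ∀ (R : BondElem G) → (∃₂ λ i j → T (G i j) × T (rel R i j)) ⊎ R ≤bond discrete
  edge-or-discrete R with any? (λ i → any? λ j → T? (G i j ∧ rel R i j))
  ... | yes (i , j , GRij) = inj₁ (i , j , Equivalence.to T-∧ GRij)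
  ... | no no-edge         = inj₂ λ i j Rij → first-step (proj₂ (proj₂ R) i j Rij)
    where
      first-step : ∀ {i j} → Path G (rel R i) i j → T (discreteRel i j)
      first-step here                     = fromWitness refl
      first-step (step {j = k} Gik Rik _) = contradiction (_ , k , Equivalence.from T-∧ (Gik , Rik)) no-edge

  +[,]-least : ∀ (P : Rel n) (R : BondElem G) {u v} → P ⊆ rel R → T (rel R u v) → P +[ u , v ] ⊆ rel R
  +[,]-least P R P⊆R Ruv i j p with +[,]-cases P p
  ... | inj₁ Pij                = P⊆R i j Pij
  ... | inj₂ (inj₁ (Piu , Pvj)) = rel-trans R (P⊆R i _ Piu) (rel-trans R Ruv (P⊆R _ j Pvj))
  ... | inj₂ (inj₂ (Piv , Puj)) = rel-trans R (P⊆R i _ Piv) (rel-trans R (rel-sym R Ruv) (P⊆R _ j Puj))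

  +[,]-cover : (P : BondElem G) {u v : Fin n}
               (bond : IsEquivB (rel P +[ u , v ]) × GConnected G (rel P +[ u , v ]))
             → ¬ T (rel P u v) → Cover (_≤bond_ {G = G}) P (rel P +[ u , v ] , bond)
  +[,]-cover P {u} {v} bond ¬Puv = record
    { below      = λ i j Pij → Equivalence.from (T-∨ {rel P i j}) (inj₁ Pij)
    ; ¬above     = λ Q≤P → ¬Puv (Q≤P u v (+[,]-relates (rel P) u v (rel-refl P)))
    ; no-between = λ {R} → between {R}
    }
    where
      Q : BondElem G
      Q = rel P +[ u , v ] , bond

      between : ∀ {R : BondElem G} → P ≤bond R → R ≤bond Q → R ≤bond P ⊎ Q ≤bond R
      between {R} P≤R R≤Q with T? (rel R u v)
      ... | yes Ruv = inj₂ (+[,]-least (rel P) R P≤R Ruv)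
      ... | no ¬Ruv = inj₁ R≤P
        where
          R≤P : R ≤bond P
          R≤P i j Rij with +[,]-cases (rel P) (R≤Q i j Rij)
          ... | inj₁ Pij                = Pij
          ... | inj₂ (inj₁ (Piu , Pvj)) = contradiction
                  (rel-trans R (rel-sym R (P≤R i u Piu)) (rel-trans R Rij (rel-sym R (P≤R v j Pvj)))) ¬Ruv
          ... | inj₂ (inj₂ (Piv , Puj)) = contradiction
                  (rel-trans R (P≤R u j Puj) (rel-trans R (rel-sym R Rij) (P≤R i v Piv))) ¬Ruv

  findPath : (S : Fin n → Bool) → ℕ → (i k : Fin n) → Maybe (Path G S i k)
  findPath S d i k with i ≟ k
  ... | yes refl = just here
  findPath S zero    i k | no _ = nothing
  findPath S (suc d) i k | no _ = foldr _<∣>_ nothing (map extend (allFin n))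
    where
      extend : Fin n → Maybe (Path G S i k)
      extend j with T? (G i j) | T? (S j)
      ... | yes Gij | yes Sj = Data.Maybe.map (step Gij Sj) (findPath S d j k)
      ... | _       | _      = nothing

  CertifiedBond : Rel n → Set
  CertifiedBond R = IsEquivB R × (∀ i j → T (R i j) → T (is-just (findPath (R i) n i j)))

  certifiedBond? : (R : Rel n) → Dec (CertifiedBond R)
  certifiedBond? R =
    (      (all? λ i → T? (R i i))
     ×-dec (all? λ i → all? λ j → T? (R i j) →-dec T? (R j i))
     ×-dec (all? λ i → all? λ j → all? λ k → T? (R i j) →-dec T? (R j k) →-dec T? (R i k)))
    ×-dec (all? λ i → all? λ j → T? (R i j) →-dec T? (is-just (findPath (R i) n i j)))

  certifiedBond⇒bond : ∀ {R} → CertifiedBond R → IsEquivB R × GConnected G R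
  certifiedBond⇒bond (equivalence , found) = equivalence , λ i j Rij → to-witness-T _ (found i j Rij)

  adjoin : (P : BondElem G) (u v : Fin n) → {True (certifiedBond? (rel P +[ u , v ]))} → BondElem G
  adjoin P u v {certified} = rel P +[ u , v ] , certifiedBond⇒bond (toWitness certified)

-- The bond lattice of the 4-cycle

next : Fin 4 → Fin 4
next = lookup (# 1 ∷ # 2 ∷ # 3 ∷ # 0 ∷ [])

opaque
  edge-certified : ∀ k → CertifiedBond {G = C4} (discreteRel +[ k , next k ])
  edge-certified = from-yes (all? λ k → certifiedBond? {G = C4} (discreteRel +[ k , next k ]))

  edge-loopless : ∀ k → ¬ T (discreteRel k (next k))
  edge-loopless = from-yes (all? λ k → ¬? (T? (discreteRel k (next k))))

edge : Fin 4 → BondElem C4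
edge k = discreteRel +[ k , next k ] , certifiedBond⇒bond (edge-certified k)

edge-atom : ∀ k → Cover _≤bond_ (discrete {G = C4}) (edge k)
edge-atom k = +[,]-cover discrete _ (edge-loopless k)

opaque
  adjacent⇒edge : ∀ u v → T (C4 u v) → ∃ λ k → rel (edge k) ⊆ discreteRel +[ u , v ]
  adjacent⇒edge = from-yes
    (all? λ u → all? λ v → T? (C4 u v) →-dec any? λ k → rel (edge k) ⊆? (discreteRel +[ u , v ]))

  three-edges-span : ∀ k₁ k₂ k₃ → k₁ ≢ k₂ → k₁ ≢ k₃ → k₂ ≢ k₃
                   → ∀ i j → T ((discreteRel +[ k₁ , next k₁ ] +[ k₂ , next k₂ ] +[ k₃ , next k₃ ]) i j)
  three-edges-span = from-yes
    (all? λ k₁ → all? λ k₂ → all? λ k₃ → ¬? (k₁ ≟ k₂) →-dec ¬? (k₁ ≟ k₃) →-dec ¬? (k₂ ≟ k₃) →-dec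
     all? λ i → all? λ j → T? ((discreteRel +[ k₁ , next k₁ ] +[ k₂ , next k₂ ] +[ k₃ , next k₃ ]) i j))

edge-below-or-discrete : ∀ R → (∃ λ k → edge k ≤bond R) ⊎ R ≤bond discrete
edge-below-or-discrete R = map₁ edge-below (edge-or-discrete R)
  where
    edge-below : (∃₂ λ u v → T (C4 u v) × T (rel R u v)) → ∃ λ k → edge k ≤bond R
    edge-below (u , v , Cuv , Ruv) with adjacent⇒edge u v Cuv
    ... | k , edge⊆uv = k , λ i j p → +[,]-least discreteRel R (discrete-least R) Ruv i j (edge⊆uv i j p)

three-edges-total : ∀ (R : BondElem C4) {k₁ k₂ k₃} → k₁ ≢ k₂ → k₁ ≢ k₃ → k₂ ≢ k₃
                  → edge k₁ ≤bond R → edge k₂ ≤bond R → edge k₃ ≤bond R → ∀ i j → T (rel R i j)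
three-edges-total R {k₁} {k₂} {k₃} k₁≢k₂ k₁≢k₃ k₂≢k₃ e₁≤R e₂≤R e₃≤R i j =
  spanned₃⊆R i j (three-edges-span k₁ k₂ k₃ k₁≢k₂ k₁≢k₃ k₂≢k₃ i j)
  where
    endpoints : ∀ {k} → edge k ≤bond R → T (rel R k (next k))
    endpoints {k} e≤R = e≤R k (next k) (+[,]-relates discreteRel k (next k) (rel-refl (discrete {G = C4})))

    spanned₁⊆R : discreteRel +[ k₁ , next k₁ ] ⊆ rel R
    spanned₁⊆R = +[,]-least _ R (discrete-least R) (endpoints e₁≤R)

    spanned₂⊆R : discreteRel +[ k₁ , next k₁ ] +[ k₂ , next k₂ ] ⊆ rel R
    spanned₂⊆R = +[,]-least _ R spanned₁⊆R (endpoints e₂≤R)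

    spanned₃⊆R : discreteRel +[ k₁ , next k₁ ] +[ k₂ , next k₂ ] +[ k₃ , next k₃ ] ⊆ rel R
    spanned₃⊆R = +[,]-least _ R spanned₂⊆R (endpoints e₃≤R)

block012 block013 matching : BondElem C4
block012 = adjoin (edge (# 0)) (# 1) (# 2)
block013 = adjoin (edge (# 0)) (# 0) (# 3)
matching = adjoin (edge (# 0)) (# 2) (# 3)

edge0⋖block012 : Cover _≤bond_ (edge (# 0)) block012
edge0⋖block012 = +[,]-cover (edge (# 0)) _ (λ ())

edge0⋖block013 : Cover _≤bond_ (edge (# 0)) block013
edge0⋖block013 = +[,]-cover (edge (# 0)) _ (λ ())

edge0⋖matching : Cover _≤bond_ (edge (# 0)) matching
edge0⋖matching = +[,]-cover (edge (# 0)) _ (λ ())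

block012≰block013 : ¬ (block012 ≤bond block013)
block012≰block013 le = le (# 0) (# 2) _

block012≰matching : ¬ (block012 ≤bond matching)
block012≰matching le = le (# 0) (# 2) _

block013≰matching : ¬ (block013 ≤bond matching)
block013≰matching le = le (# 0) (# 3) _

-- A core isomorphic to L(C₄)

module BondC4Core (L : UphoLattice) (j : UphoLattice.Carrier L) (hj : UphoLattice.IsJoinOfAtoms L j)
                  (ψ : OrdIso (UphoLattice._≤core_ L {j}) (_≤bond_ {4} {C4})) where
  open UphoLattice L renaming (_∧_ to _⊓_)
  open IsPartialOrder isPartialOrder using () renaming (trans to ≤-trans; refl to ≤-refl)
  open UphoProperties L
  open OrdIso ψ
  open OrdIsoProperties ≤-trans (λ {P} {Q} {R} → ≤bond-trans {G = C4} {P} {Q} {R}) ψ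

  ι : BondElem C4 → Carrier
  ι P = proj₁ (from P)

  ι≤j : ∀ P → ι P ≤ j
  ι≤j P = proj₂ (from P)

  ι-cover : ∀ {P Q} → Cover _≤bond_ P Q → Cover _≤_ (ι P) (ι Q)
  ι-cover P⋖Q = Cover-extend (λ _ z≤ιQ → ≤-trans z≤ιQ (ι≤j _)) (Cover-from P⋖Q)

  ≤to⇒ι≤ : ∀ {P x} (x≤j : x ≤ j) → P ≤bond to (x , x≤j) → ι P ≤ x
  ≤to⇒ι≤ x≤j P≤x = ≤-trans (from-mono P≤x) (from-to-≤ (_ , x≤j))

  ι-nonzero : ∀ {P} → ¬ (P ≤bond discrete {G = C4}) → ¬ (ι P ≤ bot)
  ι-nonzero P≰discrete ιP≤bot = P≰discrete (from-reflects {y = discrete} (≤-trans ιP≤bot (bot-min _)))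

  j≤ι-total : ∀ {R} → (∀ u v → T (rel R u v)) → j ≤ ι R
  j≤ι-total total = ≤-trans (from-to-≥ (j , ≤-refl)) (from-mono (λ u v _ → total u v))

  atom≤j : ∀ {a} → Cover _≤_ bot a → a ≤ j
  atom≤j bot⋖a = proj₁ hj _ (Cover⇒⋖ bot⋖a)

  atom⇒edge : ∀ {a} (bot⋖a : Cover _≤_ bot a) → ∃ λ k → edge k ≤bond to (a , atom≤j bot⋖a)
  atom⇒edge {a} bot⋖a with edge-below-or-discrete (to (a , atom≤j bot⋖a))
  ... | inj₁ edge≤a     = edge≤a
  ... | inj₂ a≤discrete = contradiction a≤bot (Cover.¬above bot⋖a)
    where
      a≤bot : a ≤ bot
      a≤bot = ≤-trans (from-to-≥ _)
                (≤-trans (from-mono {y = discrete} a≤discrete)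
                         (≤to⇒ι≤ (bot-min j) (discrete-least (to (bot , bot-min j)))))

  module _ {P : BondElem C4} (P≰discrete : ¬ (P ≤bond discrete {G = C4})) where
    open Filter (ι P)

    φ[j] : Carrier
    φ[j] = φ (ι≤j P)

    module _ {t : BondElem C4} (P⋖t : Cover _≤bond_ P t) where
      image : Carrier
      image = φ (Cover.below (ι-cover P⋖t))

      image-atom : Cover _≤_ bot image
      image-atom = upho-cover⇒atom _ (ι-cover P⋖t)

      image≤φ[j] : image ≤ φ[j]
      image≤φ[j] = φ-mono _ _ (ι≤j t)

      image-edge : Fin 4
      image-edge = proj₁ (atom⇒edge image-atom)

      edge≤image : edge image-edge ≤bond to (image , atom≤j image-atom)
      edge≤image = proj₂ (atom⇒edge image-atom)

    incomparable⇒distinct-edges : ∀ {t t′} (P⋖t : Cover _≤bond_ P t) (P⋖t′ : Cover _≤bond_ P t′)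
                                → ¬ (t ≤bond t′) → image-edge P⋖t ≢ image-edge P⋖t′
    incomparable⇒distinct-edges P⋖t P⋖t′ t≰t′ k≡k′ = t≰t′ (from-reflects (φ-reflects _ _ a≤a′))
      where
        k = image-edge P⋖t

        ιe≤a : ι (edge k) ≤ image P⋖t
        ιe≤a = ≤to⇒ι≤ _ (edge≤image P⋖t)

        ιe≤a′ : ι (edge k) ≤ image P⋖t′
        ιe≤a′ = subst (λ k → ι (edge k) ≤ image P⋖t′) (sym k≡k′) (≤to⇒ι≤ _ (edge≤image P⋖t′))

        a≤a′ : image P⋖t ≤ image P⋖t′
        a≤a′ = ≤-trans (atom-≤-nonzero-below (image-atom P⋖t) (ι-nonzero (Cover.¬above (edge-atom k))) ιe≤a)
                       ιe≤a′

    module _ {t₁ t₂ t₃} (P⋖t₁ : Cover _≤bond_ P t₁) (P⋖t₂ : Cover _≤bond_ P t₂) (P⋖t₃ : Cover _≤bond_ P t₃)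
             (t₁≰t₂ : ¬ (t₁ ≤bond t₂)) (t₁≰t₃ : ¬ (t₁ ≤bond t₃)) (t₂≰t₃ : ¬ (t₂ ≤bond t₃)) where

      j≤φ[j] : j ≤ φ[j]
      j≤φ[j] = ≤-trans (j≤ι-total spans) (≤-trans (from-to-≤ (y , y≤j)) (∧-lbʳ j φ[j]))
        where
          y = j ⊓ φ[j]
          y≤j = ∧-lbˡ j φ[j]

          edge≤y : ∀ {t} (P⋖t : Cover _≤bond_ P t) → edge (image-edge P⋖t) ≤bond to (y , y≤j)
          edge≤y P⋖t u v = to-mono (∧-greatest (atom≤j (image-atom P⋖t)) (image≤φ[j] P⋖t)) u v
                         ∘′ edge≤image P⋖t u v

          spans : ∀ u v → T (rel (to (y , y≤j)) u v)
          spans = three-edges-total (to (y , y≤j))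
                    (incomparable⇒distinct-edges P⋖t₁ P⋖t₂ t₁≰t₂)
                    (incomparable⇒distinct-edges P⋖t₁ P⋖t₃ t₁≰t₃)
                    (incomparable⇒distinct-edges P⋖t₂ P⋖t₃ t₂≰t₃)
                    (edge≤y P⋖t₁) (edge≤y P⋖t₂) (edge≤y P⋖t₃)

      no-three-incomparable-covers : ⊥
      no-three-incomparable-covers =
        f[x]≰x φ⁻¹ φ⁻¹-mono φ⁻¹-reflects (bot<φ⁻¹[bot] (ι-nonzero P≰discrete)) j
          (≤-trans (φ⁻¹-mono j≤φ[j]) (φ⁻¹∘φ≤ (ι≤j P)))

proposition5p7 : (L : UphoLattice) (j : UphoLattice.Carrier L)
    → UphoLattice.IsJoinOfAtoms L j
    → ¬ OrdIso (UphoLattice._≤core_ L {j}) (_≤bond_ {4} {C4})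
proposition5p7 L j hj ψ =
  BondC4Core.no-three-incomparable-covers L j hj ψ (Cover.¬above (edge-atom (# 0)))
    edge0⋖block012 edge0⋖block013 edge0⋖matching
    block012≰block013 block012≰matching block013≰matching
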